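{- Let $\mathcal F,\mathcal G\in\beta N$. Then: (a) $D(\mathcal F\cdot\mathcal G)\cap\mathcal U'\subseteq D(\mathcal F)\cup D(\mathcal G)$; (b) $(\mathcal F\cdot\mathcal G)\cap\mathcal U'\subseteq\mathcal F\cup\mathcal G$.
   Context: $N=\{1,2,3,\dots\}$, $P$ is the set of primes, and $\beta N$ is the set of ultrafilters on $N$ (each $n\in N$ identified with the principal ultrafilter at $n$). For $A\subseteq N$ and $n\in N$, $A/n=\{m\in N: mn\in A\}$ and $nN=\{nm:m\in N\}$. The product of ultrafilters is defined by $A\in\mathcal F\cdot\mathcal G\iff\{n\in N: A/n\in\mathcal G\}\in\mathcal F$. For $A\subseteq N$, $A\uparrow=\{n\in N:\exists a\in A\ a\mid n\}$. For $\mathcal F\in\beta N$, $D(\mathcal F)=\{A\subseteq N:\{n\in N: nN\subseteq A\}\in\mathcal F\}$ (a filter). $\mathcal U'=\{B\uparrow: B\subseteq P\}$. -}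

module Defs where

open import Level using (0ℓ)
open import Data.Nat using (ℕ; _*_)
open import Data.Nat.Divisibility using (_∣_)
open import Data.Nat.Primality using (Prime)
open import Data.Product using (Σ; ∃; _×_)
open import Data.Sum using (_⊎_)
open import Relation.Nullary using (¬_)
open import Relation.Unary using (Pred; _∈_; _⊆_; _∩_; ∁; ∅; U)

-- We use ℕ-predicates; the paper's N
-- excludes 0, so a subset of N is represented by a predicate on ℕ and
-- every notion below restricts attention to positive naturals.
Subset : Set₁
Subset = Pred ℕ 0ℓ

Pos : Subset
Pos n = 1 Data.Nat.≤ n
  where open import Data.Nat using (_≤_)

Family : Set₁
Family = Pred Subset 0ℓ

-- An ultrafilter on N: subsets are taken relative to N (the positive
-- naturals), so complements are relative complements N ∖ A.
record IsUltrafilter (𝓕 : Family) : Set₁ where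
  field
    full     : Pos ∈ 𝓕
    empty∉   : ¬ (∅ ∈ 𝓕)
    upward   : ∀ {A B : Subset} → A ∈ 𝓕 → A ⊆ B → B ∈ 𝓕
    inter    : ∀ {A B : Subset} → A ∈ 𝓕 → B ∈ 𝓕 → (A ∩ B) ∈ 𝓕
    ultra    : ∀ (A : Subset) → A ∈ 𝓕 ⊎ (Pos ∩ ∁ A) ∈ 𝓕

_/ₛ_ : Subset → ℕ → Subset
(A /ₛ n) m = Pos m × A (m * n)

_·_ : Family → Family → Family
(𝓕 · 𝓖) A = (λ n → Pos n × (A /ₛ n) ∈ 𝓖) ∈ 𝓕

_↑ : Subset → Subset
(A ↑) n = Pos n × Σ ℕ (λ a → A a × a ∣ n)

D : Family → Family
D 𝓕 A = (λ n → Pos n × (∀ m → Pos m → A (n * m))) ∈ 𝓕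

-- 𝓤' = { B↑ : B ⊆ P }   (membership up to extensional equality of subsets)
U′ : Pred Subset (Level.suc 0ℓ)
U′ A = Σ Subset (λ B → (∀ p → B p → Prime p) × (A ⊆ (B ↑)) × ((B ↑) ⊆ A))

-- A set A = B↑ with B ⊆ P behaves like a prime ideal of the monoid (N, ·): it
-- is closed under multiples, and mn ∈ A forces m ∈ A or n ∈ A by Euclid's
-- lemma.  Primality gives (b): if A ∈ 𝓕·𝓖 but A ∉ 𝓕 and A ∉ 𝓖, then some
-- n ∉ A has A/n ∈ 𝓖, so some m ∉ A has mn ∈ A, which is impossible.  Closure
-- under multiples makes A equal to {n : nN ⊆ A}, so A ∈ D ℋ ⇔ A ∈ ℋ for every
-- upward-closed ℋ, and (a) reduces to (b).
module Submission where

open import Defs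
open import Data.Empty using (⊥-elim)
open import Data.Nat using (suc; _*_; s≤s; z≤n)
open import Data.Nat.Divisibility using (∣m⇒∣m*n)
open import Data.Nat.Primality using (euclidsLemma)
open import Data.Nat.Properties using (*-identityʳ)
open import Data.Product using (_×_; _,_)
open import Data.Sum using (_⊎_; inj₁; inj₂; [_,_]′; map)
open import Relation.Binary.PropositionalEquality using (subst)
open import Relation.Nullary using (¬_)
open import Relation.Unary using (_∈_; _⊆_; Empty)

Multiples : Subset → Subset
Multiples A n = Pos n × (∀ m → Pos m → A (n * m))

IsPrimeSet : Subset → Set
IsPrimeSet A = ∀ {m n} → Pos m → Pos n → A (m * n) → A m ⊎ A n

UpwardClosed : Family → Set₁
UpwardClosed ℋ = ∀ {A B} → A ∈ ℋ → A ⊆ B → B ∈ ℋ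

pos-* : ∀ {n m} → Pos n → Pos m → Pos (n * m)
pos-* {suc _} {suc _} _ _ = s≤s z≤n

Multiples⊆ : (A : Subset) → Multiples A ⊆ A
Multiples⊆ A {n} (_ , nN⊆A) = subst A (*-identityʳ n) (nN⊆A 1 (s≤s z≤n))

U′⇒⊆Multiples : ∀ {A} → A ∈ U′ → A ⊆ Multiples A
U′⇒⊆Multiples (B , _ , A⊆B↑ , B↑⊆A) An with A⊆B↑ An
... | pn , p , p∈B , p∣n = pn , λ m pm → B↑⊆A (pos-* pn pm , p , p∈B , ∣m⇒∣m*n m p∣n)

U′⇒isPrimeSet : ∀ {A} → A ∈ U′ → IsPrimeSet A
U′⇒isPrimeSet (B , B⊆P , A⊆B↑ , B↑⊆A) {m} {n} pm pn Amn with A⊆B↑ Amn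
... | _ , p , p∈B , p∣mn = map (λ p∣m → B↑⊆A (pm , p , p∈B , p∣m))
                               (λ p∣n → B↑⊆A (pn , p , p∈B , p∣n))
                               (euclidsLemma m n (B⊆P p p∈B) p∣mn)

·-upwardClosed : {𝓕 𝓖 : Family} → UpwardClosed 𝓕 → UpwardClosed 𝓖 →
                 UpwardClosed (𝓕 · 𝓖)
·-upwardClosed up𝓕 up𝓖 A∈ A⊆B =
  up𝓕 A∈ (λ (pn , A/n∈𝓖) → pn , up𝓖 A/n∈𝓖 (λ (pm , Amn) → pm , A⊆B Amn))

D⊆ : ∀ {ℋ} → UpwardClosed ℋ → (A : Subset) → A ∈ D ℋ → A ∈ ℋ
D⊆ upℋ A A∈D = upℋ A∈D (Multiples⊆ A)

module _ {𝓕 : Family} (ult : IsUltrafilter 𝓕) where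
  open IsUltrafilter ult

  ∈⇒¬Empty : ∀ {X} → X ∈ 𝓕 → ¬ Empty X
  ∈⇒¬Empty X∈ X-empty = empty∉ (upward X∈ (λ {n} Xn → ⊥-elim (X-empty n Xn)))

isPrimeSet-∈·⇒∈⊎∈ : ∀ {𝓕 𝓖 A} → IsUltrafilter 𝓕 → IsUltrafilter 𝓖 →
                    IsPrimeSet A → A ∈ 𝓕 · 𝓖 → A ∈ 𝓕 ⊎ A ∈ 𝓖
isPrimeSet-∈·⇒∈⊎∈ {A = A} ult𝓕 ult𝓖 prime A∈
  with IsUltrafilter.ultra ult𝓕 A | IsUltrafilter.ultra ult𝓖 A
... | inj₁ A∈𝓕 | _         = inj₁ A∈𝓕
... | inj₂ _   | inj₁ A∈𝓖 = inj₂ A∈𝓖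
... | inj₂ ∁A∈𝓕 | inj₂ ∁A∈𝓖 =
  ⊥-elim (∈⇒¬Empty ult𝓕 (IsUltrafilter.inter ult𝓕 A∈ ∁A∈𝓕)
    λ n ((pn , A/n∈𝓖) , _ , n∉A) →
      ∈⇒¬Empty ult𝓖 (IsUltrafilter.inter ult𝓖 A/n∈𝓖 ∁A∈𝓖)
        λ m ((pm , Amn) , _ , m∉A) → [ m∉A , n∉A ]′ (prime pm pn Amn))

lemma2p1 : (𝓕 𝓖 : Family) → IsUltrafilter 𝓕 → IsUltrafilter 𝓖 →
    (∀ A → A ∈ D (𝓕 · 𝓖) → A ∈ U′ → A ∈ D 𝓕 ⊎ A ∈ D 𝓖)
    × (∀ A → A ∈ (𝓕 · 𝓖) → A ∈ U′ → A ∈ 𝓕 ⊎ A ∈ 𝓖)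
lemma2p1 𝓕 𝓖 ult𝓕 ult𝓖 = partA , partB
  where
  up𝓕 = IsUltrafilter.upward ult𝓕
  up𝓖 = IsUltrafilter.upward ult𝓖

  partB : ∀ A → A ∈ (𝓕 · 𝓖) → A ∈ U′ → A ∈ 𝓕 ⊎ A ∈ 𝓖
  partB A A∈ u = isPrimeSet-∈·⇒∈⊎∈ ult𝓕 ult𝓖 (U′⇒isPrimeSet u) A∈

  partA : ∀ A → A ∈ D (𝓕 · 𝓖) → A ∈ U′ → A ∈ D 𝓕 ⊎ A ∈ D 𝓖
  partA A A∈D u =
    map (λ A∈𝓕 → up𝓕 A∈𝓕 (U′⇒⊆Multiples u)) (λ A∈𝓖 → up𝓖 A∈𝓖 (U′⇒⊆Multiples u))
        (partB A (D⊆ (·-upwardClosed up𝓕 up𝓖) A A∈D) u)
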